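{- Let $c,d$ be unlabeled configurations on $\mathbb{Z}$ with $c\to d$. Then $\min(\widetilde{c})\leq\min(d)$.
   Context: Unlabeled chip-firing on $\mathbb{Z}$: a configuration is a function $c\colon\mathbb{Z}\to\mathbb{N}$ with finite total sum; if $c(i)\geq2$ one may fire at $i$, moving one chip from $i$ to $i-1$ and one to $i+1$. $c\to d$ means $d$ is obtained from $c$ by zero or more firings. $c$ is stable if $c(i)\leq1$ for all $i$; every $c$ has a unique stable $\widetilde{c}$ with $c\to\widetilde{c}$. $\min(c)$ is the least $i$ with $c(i)\geq1$ ($\infty$ if none). -}

module Defs where

open import Data.Nat using (ℕ; _≤_; _+_; _∸_)
open import Data.Integer as ℤ using (ℤ; ∣_∣)
open import Data.Product using (Σ; ∃; _×_)
open import Relation.Binary.PropositionalEquality using (_≡_)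
open import Relation.Nullary using (yes; no)
open import Relation.Binary.Construct.Closure.ReflexiveTransitive using (Star)

-- An unlabeled chip configuration on ℤ: number of chips at each site.
Config : Set
Config = ℤ → ℕ

FiniteSupport : Config → Set
FiniteSupport c = ∃ λ (N : ℕ) → ∀ (i : ℤ) → N ≤ ∣ i ∣ → c i ≡ 0

-- The configuration obtained by firing at site i (meaningful when c i ≥ 2):
-- site i loses two chips, sites i-1 and i+1 gain one chip each.
fire : ℤ → Config → Config
fire i c j with j ℤ.≟ i
... | yes _ = c j ∸ 2
... | no _ with j ℤ.≟ (i ℤ.- ℤ.1ℤ)
...   | yes _ = c j + 1
...   | no _ with j ℤ.≟ (i ℤ.+ ℤ.1ℤ)
...     | yes _ = c j + 1
...     | no _ = c j

Step : Config → Config → Set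
Step c d = ∃ λ (i : ℤ) → (2 ≤ c i) × (∀ j → d j ≡ fire i c j)

_⟶*_ : Config → Config → Set
c ⟶* d = Star Step c d

Stable : Config → Set
Stable c = ∀ (i : ℤ) → c i ≤ 1

-- min(c) ≤ min(d) in ℤ ∪ {∞}, where min(c) is the least occupied site
-- (∞ if none): every occupied site of d has an occupied site of c at or left of it.
MinLe : Config → Config → Set
MinLe c d = ∀ (i : ℤ) → 1 ≤ d i → ∃ λ (j : ℤ) → (j ℤ.≤ i) × (1 ≤ c j)

-- Firings at distinct sites commute, so chip-firing is strongly confluent
-- (up to pointwise equality of configurations). Hence d and the stable s have a
-- common descendant, which must be s itself because s admits no firing. A firing
-- never moves the leftmost chip to the right, since the left neighbour of the
-- fired site gains a chip; so min(s) ≤ min(d).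
module Submission where

open import Level using (Level)
open import Defs
open import Data.Nat as ℕ using (ℕ; _+_; _∸_)
import Data.Nat.Properties as ℕP
open import Data.Integer as ℤ using (ℤ; 1ℤ; _-_)
import Data.Integer.Properties as ℤP
open import Data.Product using (∃; ∃₂; _×_; _,_)
open import Data.Sum using (_⊎_; inj₁; inj₂)
open import Data.Empty using (⊥-elim)
open import Relation.Nullary using (yes; no)
open import Relation.Binary using (Rel; IsEquivalence; Setoid)
open import Function using (_∘_)
open import Relation.Binary.PropositionalEquality
open import Relation.Binary.Construct.Closure.ReflexiveTransitive using (Star; ε; _◅_; _◅◅_)
open import Algebra.Properties.CommutativeSemigroup ℕP.+-commutativeSemigroup using (xy∙z≈xz∙y)

module StrongConfluence
  {a ℓ r : Level} {A : Set a} {_≈_ : Rel A ℓ} (≈-isEquivalence : IsEquivalence _≈_)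
  {_⟶_ : Rel A r}
  (⟶-respˡ-≈ : ∀ {x x′ y} → x ≈ x′ → x ⟶ y → x′ ⟶ y)
  (diamond : ∀ {x y z} → x ⟶ y → x ⟶ z → y ≈ z ⊎ ∃ λ w → y ⟶ w × z ⟶ w)
  where

  open IsEquivalence ≈-isEquivalence
    renaming (refl to ≈-refl; sym to ≈-sym; trans to ≈-trans)

  Joinable : Rel A _
  Joinable y z = ∃₂ λ y′ z′ → Star _⟶_ y y′ × Star _⟶_ z z′ × y′ ≈ z′

  star-respˡ-≈ : ∀ {x x′ y} → x ≈ x′ → Star _⟶_ x y →
    ∃ λ y′ → Star _⟶_ x′ y′ × y ≈ y′
  star-respˡ-≈ {x′ = x′} x≈x′ ε = x′ , ε , x≈x′
  star-respˡ-≈ {y = y} x≈x′ (x⟶x₁ ◅ x₁⟶*y) = y , ⟶-respˡ-≈ x≈x′ x⟶x₁ ◅ x₁⟶*y , ≈-refl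

  strip : ∀ {x y z} → x ⟶ y → Star _⟶_ x z → Joinable y z
  strip {y = y} x⟶y ε = y , y , ε , x⟶y ◅ ε , ≈-refl
  strip x⟶y (x⟶z₁ ◅ z₁⟶*z) with diamond x⟶y x⟶z₁
  ... | inj₁ y≈z₁ with star-respˡ-≈ (≈-sym y≈z₁) z₁⟶*z
  ...   | z′ , y⟶*z′ , z≈z′ = z′ , _ , y⟶*z′ , ε , ≈-sym z≈z′
  strip x⟶y (x⟶z₁ ◅ z₁⟶*z) | inj₂ (w , y⟶w , z₁⟶w) with strip z₁⟶w z₁⟶*z
  ... | w′ , z′ , w⟶*w′ , z⟶*z′ , w′≈z′ = w′ , z′ , y⟶w ◅ w⟶*w′ , z⟶*z′ , w′≈z′

  confluent : ∀ {x y z} → Star _⟶_ x y → Star _⟶_ x z → Joinable y z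
  confluent {z = z} ε x⟶*z = z , z , x⟶*z , ε , ≈-refl
  confluent (x⟶x₁ ◅ x₁⟶*y) x⟶*z with strip x⟶x₁ x⟶*z
  ... | u , z′ , x₁⟶*u , z⟶*z′ , u≈z′ with confluent x₁⟶*y x₁⟶*u
  ...   | y′ , u′ , y⟶*y′ , u⟶*u′ , y′≈u′ with star-respˡ-≈ u≈z′ u⟶*u′
  ...     | v , z′⟶*v , u′≈v = y′ , v , y⟶*y′ , z⟶*z′ ◅◅ z′⟶*v , ≈-trans y′≈u′ u′≈v

gain : ℤ → ℤ → ℕ
gain i j with j ℤ.≟ i - 1ℤ
... | yes _ = 1
... | no _ with j ℤ.≟ i ℤ.+ 1ℤ
...   | yes _ = 1
...   | no _ = 0

afterFiring : ℤ → ℤ → ℕ → ℕ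
afterFiring i j n with j ℤ.≟ i
... | yes _ = n ∸ 2
... | no _ = n + gain i j

fire≡afterFiring : ∀ i c j → fire i c j ≡ afterFiring i j (c j)
fire≡afterFiring i c j with j ℤ.≟ i
... | yes _ = refl
... | no _ with j ℤ.≟ i - 1ℤ
...   | yes _ = refl
...   | no _ with j ℤ.≟ i ℤ.+ 1ℤ
...     | yes _ = refl
...     | no _ = sym (ℕP.+-identityʳ _)

afterFiring-≢ : ∀ {i j} n → j ≢ i → afterFiring i j n ≡ n + gain i j
afterFiring-≢ {i} {j} n j≢i with j ℤ.≟ i
... | yes j≡i = ⊥-elim (j≢i j≡i)
... | no _ = refl

afterFiring-comm : ∀ {i k} j n → i ≢ k → (j ≡ i → 2 ℕ.≤ n) → (j ≡ k → 2 ℕ.≤ n) →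
  afterFiring k j (afterFiring i j n) ≡ afterFiring i j (afterFiring k j n)
afterFiring-comm {i} {k} j n i≢k legalᵢ legalₖ with j ℤ.≟ i | j ℤ.≟ k
... | yes refl | yes j≡k = ⊥-elim (i≢k j≡k)
... | yes j≡i  | no _    = sym (ℕP.+-∸-comm (gain k j) (legalᵢ j≡i))
... | no _     | yes j≡k = ℕP.+-∸-comm (gain i j) (legalₖ j≡k)
... | no _     | no _    = xy∙z≈xz∙y n (gain i j) (gain k j)

i-1<i : ∀ i → i - 1ℤ ℤ.< i
i-1<i i rewrite ℤP.+-comm i ℤ.-1ℤ = ℤP.i≤pred[j]⇒i<j ℤP.≤-refl

gain-left-neighbour : ∀ i → gain i (i - 1ℤ) ≡ 1
gain-left-neighbour i with i - 1ℤ ℤ.≟ i - 1ℤ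
... | yes _ = refl
... | no i-1≢i-1 = ⊥-elim (i-1≢i-1 refl)

fire-left-neighbour : ∀ i c → fire i c (i - 1ℤ) ≡ c (i - 1ℤ) + 1
fire-left-neighbour i c = begin
  fire i c (i - 1ℤ)                            ≡⟨ fire≡afterFiring i c (i - 1ℤ) ⟩
  afterFiring i (i - 1ℤ) (c (i - 1ℤ))          ≡⟨ afterFiring-≢ (c (i - 1ℤ)) (ℤP.<⇒≢ (i-1<i i)) ⟩
  c (i - 1ℤ) + gain i (i - 1ℤ)                 ≡⟨ cong (c (i - 1ℤ) +_) (gain-left-neighbour i) ⟩
  c (i - 1ℤ) + 1                               ∎
  where open ≡-Reasoning

≗fire-≢-mono : ∀ {i j c d} → d ≗ fire i c → j ≢ i → c j ℕ.≤ d j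
≗fire-≢-mono {i} {j} {c} d≗fire j≢i = begin
  c j                    ≤⟨ ℕP.m≤m+n (c j) (gain i j) ⟩
  c j + gain i j         ≡⟨ afterFiring-≢ (c j) j≢i ⟨
  afterFiring i j (c j)  ≡⟨ fire≡afterFiring i c j ⟨
  fire i c j             ≡⟨ d≗fire j ⟨
  _                      ∎
  where open ℕP.≤-Reasoning

Step-respˡ-≗ : ∀ {c c′ d} → c ≗ c′ → Step c d → Step c′ d
Step-respˡ-≗ {c} {c′} c≗c′ (i , legal , d≗fire) =
  i , subst (2 ℕ.≤_) (c≗c′ i) legal , λ j → begin
    _                       ≡⟨ d≗fire j ⟩
    fire i c j              ≡⟨ fire≡afterFiring i c j ⟩
    afterFiring i j (c j)   ≡⟨ cong (afterFiring i j) (c≗c′ j) ⟩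
    afterFiring i j (c′ j)  ≡⟨ fire≡afterFiring i c′ j ⟨
    fire i c′ j             ∎
  where open ≡-Reasoning

Step-diamond : ∀ {c a b} → Step c a → Step c b → a ≗ b ⊎ ∃ λ e → Step a e × Step b e
Step-diamond {c} {a} {b} (i , legalᵢ , a≗fire) (k , legalₖ , b≗fire) with i ℤ.≟ k
... | yes refl = inj₁ λ j → trans (a≗fire j) (sym (b≗fire j))
... | no i≢k = inj₂ (fire k a , a⟶e , b⟶e)
  where
  a⟶e : Step a (fire k a)
  a⟶e = k , ℕP.≤-trans legalₖ (≗fire-≢-mono a≗fire (i≢k ∘ sym)) , λ _ → refl

  b⟶e : Step b (fire k a)
  b⟶e = i , ℕP.≤-trans legalᵢ (≗fire-≢-mono b≗fire i≢k) , λ j → begin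
    fire k a j                                ≡⟨ fire≡afterFiring k a j ⟩
    afterFiring k j (a j)                     ≡⟨ cong (afterFiring k j) (trans (a≗fire j) (fire≡afterFiring i c j)) ⟩
    afterFiring k j (afterFiring i j (c j))   ≡⟨ afterFiring-comm j (c j) i≢k (λ { refl → legalᵢ }) (λ { refl → legalₖ }) ⟩
    afterFiring i j (afterFiring k j (c j))   ≡⟨ cong (afterFiring i j) (trans (b≗fire j) (fire≡afterFiring k c j)) ⟨
    afterFiring i j (b j)                     ≡⟨ fire≡afterFiring i b j ⟨
    fire i b j                                ∎
    where open ≡-Reasoning

open StrongConfluence {_≈_ = _≗_} (Setoid.isEquivalence (_ →-setoid ℕ)) Step-respˡ-≗ Step-diamond

Stable⇒irreducible : ∀ {s t} → Stable s → s ⟶* t → s ≡ t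
Stable⇒irreducible stable ε = refl
Stable⇒irreducible stable ((i , legal , _) ◅ _) =
  ⊥-elim (ℕP.<-irrefl refl (ℕP.≤-trans legal (stable i)))

MinLe-refl : ∀ c → MinLe c c
MinLe-refl c i occupied = i , ℤP.≤-refl , occupied

MinLe-trans : ∀ {a b c} → MinLe a b → MinLe b c → MinLe a c
MinLe-trans a≤b b≤c i occupied with b≤c i occupied
... | j , j≤i , occupiedⱼ with a≤b j occupiedⱼ
...   | k , k≤j , occupiedₖ = k , ℤP.≤-trans k≤j j≤i , occupiedₖ

MinLe-respˡ-≗ : ∀ {a a′ b} → a ≗ a′ → MinLe a b → MinLe a′ b
MinLe-respˡ-≗ a≗a′ a≤b i occupied with a≤b i occupied
... | j , j≤i , occupiedⱼ = j , j≤i , subst (1 ℕ.≤_) (a≗a′ j) occupiedⱼ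

MinLe-after-Step : ∀ {c d} → Step c d → MinLe d c
MinLe-after-Step {c} (k , _ , d≗fire) i occupied with i ℤ.≟ k
... | yes refl = i - 1ℤ , ℤP.<⇒≤ (i-1<i i) ,
  subst (1 ℕ.≤_) (sym (trans (d≗fire (i - 1ℤ)) (fire-left-neighbour i c))) (ℕP.m≤n+m 1 _)
... | no i≢k = i , ℤP.≤-refl ,
  ℕP.≤-trans occupied (≗fire-≢-mono d≗fire i≢k)

MinLe-after-⟶* : ∀ {c d} → c ⟶* d → MinLe d c
MinLe-after-⟶* {c} ε = MinLe-refl c
MinLe-after-⟶* (c⟶c₁ ◅ c₁⟶*d) = MinLe-trans (MinLe-after-⟶* c₁⟶*d) (MinLe-after-Step c⟶c₁)

proposition2p8 : (c d s : Config) → FiniteSupport c → c ⟶* d →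
    c ⟶* s → Stable s → MinLe s d
proposition2p8 c d s _ c⟶*d c⟶*s stable with confluent c⟶*d c⟶*s
... | e , e′ , d⟶*e , s⟶*e′ , e≗e′ with Stable⇒irreducible stable s⟶*e′
... | refl = MinLe-respˡ-≗ e≗e′ (MinLe-after-⟶* d⟶*e)
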